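{- For every integer $n\geq 0$, \[ M_{bd}(0,2,2n)>M_{bd}(1,2,2n)\qquad\text{and}\qquad M_{bd}(1,2,2n+1)>M_{bd}(0,2,2n+1). \]
   Context: A partition with designated summands is an integer partition in which, for each distinct part size occurring, exactly one of the parts of that size is tagged (designated). A bipartition of $n$ with designated summands is an ordered pair $(\lambda_1,\lambda_2)$ of partitions with designated summands with $|\lambda_1|+|\lambda_2|=n$. Fix a bijection $\Delta$ (such a bijection exists) between partitions of $N$ with designated summands and pairs $(\alpha,\beta)$ with $|\alpha|+|\beta|=N$, where $\alpha$ is an ordinary partition and $\beta$ is a partition into parts $\not\equiv\pm1 \pmod 6$. If $\Delta(\lambda_1)=(\alpha_1,\beta_1)$ and $\Delta(\lambda_2)=(\alpha_2,\beta_2)$, the $pd$-crank of $(\lambda_1,\lambda_2)$ is $\ell(\alpha_1)-\ell(\alpha_2)$, where $\ell(\alpha)$ is the number of parts of $\alpha$. Because $\Delta$ is a bijection, $M_{bd}(m,n)$, the number of bipartitions of $n$ with designated summands having $pd$-crank $m$, equals the number of quadruples $(\alpha_1,\beta_1,\alpha_2,\beta_2)$ with $\alpha_1,\alpha_2$ ordinary partitions, $\beta_1,\beta_2$ partitions into parts $\not\equiv\pm1\pmod 6$, $|\alpha_1|+|\beta_1|+|\alpha_2|+|\beta_2|=n$ and $\ell(\alpha_1)-\ell(\alpha_2)=m$. Equivalently, \[ \sum_{m\in\mathbb Z}\sum_{n\ge0}M_{bd}(m,n)z^mq^n=\frac{(q^6;q^6)_\infty^2}{(zq;q)_\infty(z^{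 -1}q;q)_\infty(q^2;q^2)_\infty^2(q^3;q^3)_\infty^2}, \] where $(a;q)_\infty=\prod_{j\ge1}(1-aq^{j-1})$. $M_{bd}(k,t,n)$ denotes the number of bipartitions of $n$ with designated summands whose $pd$-crank is congruent to $k$ modulo $t$, i.e. $M_{bd}(k,t,n)=\sum_{m\equiv k \,(\mathrm{mod}\, t)}M_{bd}(m,n)$. -}

module Defs where

open import Data.Bool using (Bool; true; false; if_then_else_)
open import Data.Nat as ℕ using (ℕ; zero; suc; _+_; _*_; _∸_; NonZero)
open import Data.Nat.DivMod using (_/_)
open import Data.Integer as ℤ using (ℤ; +_; _-_; _%ℕ_)
open import Data.List using (List; []; _∷_; _++_; length; map; concatMap; replicate; upTo; filter)
open import Data.Product using (_×_; _,_)
open import Relation.Nullary.Decidable using (does)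

-- A partition is represented as a weakly decreasing list of positive parts.
-- partsUpTo ok k n : all partitions of n whose parts are ≤ k and satisfy ok
-- (each partition listed exactly once, by choosing the multiplicity of
--  each part size k, k-1, ..., 1).
partsUpTo : (ℕ → Bool) → ℕ → ℕ → List (List ℕ)
partsUpTo ok zero zero = [] ∷ []
partsUpTo ok zero (suc n) = []
partsUpTo ok (suc k) n =
  concatMap
    (λ m → map (replicate m (suc k) ++_) (partsUpTo ok k (n ∸ m * suc k)))
    (if ok (suc k) then upTo (suc (n / suc k)) else (0 ∷ []))

partitions : ℕ → List (List ℕ)
partitions n = partsUpTo (λ _ → true) n n

not±1mod6 : ℕ → Bool
not±1mod6 j with j ℕ.% 6
... | 1 = false
... | 5 = false
... | _ = true

partitionsNot±1mod6 : ℕ → List (List ℕ)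
partitionsNot±1mod6 n = partsUpTo not±1mod6 n n

-- Quadruples (α₁, β₁, α₂, β₂): α's ordinary partitions, β's partitions into
-- parts ≢ ±1 (mod 6), with |α₁|+|β₁|+|α₂|+|β₂| = n.
Quad : Set
Quad = List ℕ × List ℕ × List ℕ × List ℕ

quads : ℕ → List Quad
quads n =
  concatMap (λ a → concatMap (λ b → concatMap (λ c →
    let d = n ∸ a ∸ b ∸ c in
    concatMap (λ α₁ → concatMap (λ β₁ → concatMap (λ α₂ → map (λ β₂ →
        (α₁ , β₁ , α₂ , β₂))
      (partitionsNot±1mod6 d))
      (partitions c))
      (partitionsNot±1mod6 b))
      (partitions a))
    (upTo (suc (n ∸ a ∸ b))))
    (upTo (suc (n ∸ a))))
    (upTo (suc n))

pdCrank : Quad → ℤ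
pdCrank (α₁ , _ , α₂ , _) = + length α₁ - + length α₂

Mbd : ℤ → ℕ → ℕ
Mbd m n = length (filter (λ q → pdCrank q ℤ.≟ m) (quads n))

MbdMod : ℤ → (t : ℕ) .{{_ : NonZero t}} → ℕ → ℕ
MbdMod k t n = length (filter (λ q → ((pdCrank q - k) %ℕ t) ℕ.≟ 0) (quads n))

module Submission where

-- Weighting each quadruple by (−1)^(ℓ(α₁)+ℓ(α₂)) counts M_bd(0,2,n) − M_bd(1,2,n), so this difference is the
-- coefficient of q^n in the generating function at z = −1, namely ∏_k 1/((1+q^k)² (1−q^k)^(2[k ≢ ±1 mod 6])).
-- Substituting q ↦ −q merges the factors at each k into 1/(1−q^k) (k ≡ ±1 mod 6) or 1/(1−q^(2k)) (otherwise),
-- so (−1)^n times the difference is a coefficient of a product of geometric series that includes 1/(1−q),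
-- hence at least 1.

module CrankParityBias where
  open import Defs
  open import Data.Bool using (Bool; true; false; if_then_else_)
  open import Data.Nat as ℕ using (ℕ; zero; suc; z≤n; s≤s; _≤′_; ≤′-refl; ≤′-step)
  import Data.Nat.Properties as ℕₚ
  open import Data.Nat.DivMod using (_/_; _%_; m<n⇒m/n≡0; m/n≡1+[m∸n]/n; m≡m%n+[m/n]*n; m%n<n; [m+n]%n≡m%n)
  open import Data.Nat.Induction using (<-rec)
  open import Data.Integer using (ℤ; +_; +≤+; 0ℤ; 1ℤ; -1ℤ; _+_; _-_; _*_; -_; _^_; _≤_; _⊖_; _%ℕ_; nonNegative)
  import Data.Integer.Properties as ℤₚ
  open import Data.Integer.Tactic.RingSolver using (solve-∀)
  open import Data.List using (List; []; _∷_; _++_; map; concatMap; length; replicate; filter; upTo)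
  open import Data.List.Properties using (map-upTo; length-++; length-replicate; filter-accept; filter-reject)
  open import Data.List.Membership.Propositional using (_∈_)
  open import Data.List.Membership.Propositional.Properties using (∈-upTo⁻)
  open import Data.List.Relation.Unary.Any using (here; there)
  open import Data.Product using (_×_; _,_)
  open import Data.Sum using (_⊎_; inj₁; inj₂)
  open import Function using (_∘_)
  open import Function.Definitions using (Congruent)
  open import Relation.Binary.PropositionalEquality
  open import Relation.Nullary using (¬_; yes; no)
  open import Relation.Unary using (Decidable)

  variable
    A B : Set

  ∑ : List A → (A → ℤ) → ℤ
  ∑ []       w = 0ℤ
  ∑ (x ∷ xs) w = w x + ∑ xs w

  ∑-cong-∈ : ∀ (xs : List A) {w v : A → ℤ} → (∀ {x} → x ∈ xs → w x ≡ v x) → ∑ xs w ≡ ∑ xs v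
  ∑-cong-∈ []       eq = refl
  ∑-cong-∈ (x ∷ xs) eq = cong₂ _+_ (eq (here refl)) (∑-cong-∈ xs (eq ∘ there))

  ∑-cong : ∀ (xs : List A) {w v : A → ℤ} → w ≗ v → ∑ xs w ≡ ∑ xs v
  ∑-cong xs eq = ∑-cong-∈ xs (λ {x} _ → eq x)

  ∑-++ : ∀ (xs ys : List A) w → ∑ (xs ++ ys) w ≡ ∑ xs w + ∑ ys w
  ∑-++ []       ys w = sym (ℤₚ.+-identityˡ _)
  ∑-++ (x ∷ xs) ys w = trans (cong (_+_ (w x)) (∑-++ xs ys w)) (sym (ℤₚ.+-assoc (w x) _ _))

  ∑-concatMap : ∀ (f : A → List B) xs w → ∑ (concatMap f xs) w ≡ ∑ xs (λ x → ∑ (f x) w)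
  ∑-concatMap f []       w = refl
  ∑-concatMap f (x ∷ xs) w = trans (∑-++ (f x) (concatMap f xs) w) (cong (_+_ (∑ (f x) w)) (∑-concatMap f xs w))

  ∑-map : ∀ (f : A → B) xs w → ∑ (map f xs) w ≡ ∑ xs (w ∘ f)
  ∑-map f []       w = refl
  ∑-map f (x ∷ xs) w = cong (_+_ (w (f x))) (∑-map f xs w)

  ∑-*ˡ : ∀ (xs : List A) c w → ∑ xs (λ x → c * w x) ≡ c * ∑ xs w
  ∑-*ˡ []       c w = sym (ℤₚ.*-zeroʳ c)
  ∑-*ˡ (x ∷ xs) c w = trans (cong (_+_ (c * w x)) (∑-*ˡ xs c w)) (sym (ℤₚ.*-distribˡ-+ c (w x) _))

  ∑-*ʳ : ∀ (xs : List A) w c → ∑ xs (λ x → w x * c) ≡ ∑ xs w * c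
  ∑-*ʳ xs w c = trans (∑-cong xs (λ x → ℤₚ.*-comm (w x) c)) (trans (∑-*ˡ xs c w) (ℤₚ.*-comm c _))

  ∑-*-* : ∀ (xs : List A) a w r → ∑ xs (λ x → (a * w x) * r) ≡ a * (∑ xs w * r)
  ∑-*-* xs a w r =
    trans (∑-cong xs (λ x → ℤₚ.*-assoc a (w x) r))
          (trans (∑-*ˡ xs a (λ x → w x * r)) (cong (a *_) (∑-*ʳ xs w r)))

  ∑-linear : ∀ (xs : List A) w v c → ∑ xs (λ x → w x - c * v x) ≡ ∑ xs w - c * ∑ xs v
  ∑-linear []       w v c = sym (cong (_-_ 0ℤ) (ℤₚ.*-zeroʳ c))
  ∑-linear (x ∷ xs) w v c =
    trans (cong (_+_ (w x - c * v x)) (∑-linear xs w v c)) (regroup (w x) (v x) (∑ xs w) (∑ xs v) c)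
    where
    regroup : ∀ a b s t c → (a - c * b) + (s - c * t) ≡ (a + s) - c * (b + t)
    regroup = solve-∀

  ∑-nonneg : ∀ (xs : List A) {w} → (∀ x → 0ℤ ≤ w x) → 0ℤ ≤ ∑ xs w
  ∑-nonneg []       nonneg = ℤₚ.≤-refl
  ∑-nonneg (x ∷ xs) nonneg = ℤₚ.+-mono-≤ (nonneg x) (∑-nonneg xs nonneg)

  ∑-upTo-suc : ∀ n w → ∑ (upTo (suc n)) w ≡ w 0 + ∑ (upTo n) (w ∘ suc)
  ∑-upTo-suc n w = cong (_+_ (w 0)) (trans (cong (λ l → ∑ l w) (sym (map-upTo suc n))) (∑-map suc (upTo n) w))

  -- Formal power series and the factors 1 − c q^k

  Series : Set
  Series = ℕ → ℤ

  δ : Series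
  δ zero    = 1ℤ
  δ (suc _) = 0ℤ

  Nonneg : Series → Set
  Nonneg F = ∀ n → 0ℤ ≤ F n

  shift : ℕ → Series → Series
  shift zero    F n       = F n
  shift (suc k) F zero    = 0ℤ
  shift (suc k) F (suc n) = shift k F n

  shift-local : ∀ k {F G} n → (∀ {m} → m ℕ.≤ n → F m ≡ G m) → shift k F n ≡ shift k G n
  shift-local zero    n       eq = eq ℕₚ.≤-refl
  shift-local (suc k) zero    eq = refl
  shift-local (suc k) (suc n) eq = shift-local k n (eq ∘ ℕₚ.m≤n⇒m≤1+n)

  shift-strictly-local : ∀ k {F G} n → (∀ {m} → m ℕ.< n → F m ≡ G m) → shift (suc k) F n ≡ shift (suc k) G n
  shift-strictly-local k zero    eq = refl
  shift-strictly-local k (suc n) eq = shift-local k n (eq ∘ s≤s)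

  shift-below : ∀ k F {n} → n ℕ.< k → shift k F n ≡ 0ℤ
  shift-below (suc k) F {zero}  _         = refl
  shift-below (suc k) F {suc n} (s≤s n<k) = shift-below k F n<k

  shift-above : ∀ k F r → shift k F (k ℕ.+ r) ≡ F r
  shift-above zero    F r = refl
  shift-above (suc k) F r = shift-above k F r

  -- mulFactor i c and divFactor i c multiply and divide by 1 - c q^(1+i).
  mulFactor : ℕ → ℤ → Series → Series
  mulFactor i c Y n = Y n - c * shift (suc i) Y n

  divFactor : ℕ → ℤ → Series → Series
  divFactor i c f n = ∑ (upTo (suc (n / suc i))) (λ j → c ^ j * f (n ℕ.∸ j ℕ.* suc i))

  mulFactor-cong : ∀ i c → Congruent _≗_ _≗_ (mulFactor i c)
  mulFactor-cong i c eq n = cong₂ (λ y s → y - c * s) (eq n) (shift-local (suc i) n (λ {m} _ → eq m))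

  divFactor-cong : ∀ i c → Congruent _≗_ _≗_ (divFactor i c)
  divFactor-cong i c eq n = ∑-cong (upTo (suc (n / suc i))) (λ j → cong (c ^ j *_) (eq (n ℕ.∸ j ℕ.* suc i)))


  divFactor-below : ∀ i c f {n} → n ℕ.< suc i → divFactor i c f n ≡ f n
  divFactor-below i c f {n} n<k = begin
      divFactor i c f n
    ≡⟨ cong (λ q → ∑ (upTo (suc q)) (λ j → c ^ j * f (n ℕ.∸ j ℕ.* suc i))) (m<n⇒m/n≡0 n<k) ⟩
      1ℤ * f n + 0ℤ
    ≡⟨ trans (ℤₚ.+-identityʳ _) (ℤₚ.*-identityˡ (f n)) ⟩
      f n
    ∎
    where open ≡-Reasoning

  divFactor-recurrence : ∀ i c f n → divFactor i c f n ≡ f n + c * shift (suc i) (divFactor i c f) n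
  divFactor-recurrence i c f n with suc i ℕ.≤? n
  ... | no n≱k = begin
      divFactor i c f n                            ≡⟨ divFactor-below i c f n<k ⟩
      f n                                          ≡⟨ sym (ℤₚ.+-identityʳ (f n)) ⟩
      f n + 0ℤ                                     ≡⟨ cong (_+_ (f n)) (sym (ℤₚ.*-zeroʳ c)) ⟩
      f n + c * 0ℤ                                 ≡⟨ cong (λ s → f n + c * s) (sym (shift-below (suc i) (divFactor i c f) n<k)) ⟩
      f n + c * shift (suc i) (divFactor i c f) n  ∎
    where
    open ≡-Reasoning
    n<k = ℕₚ.≰⇒> n≱k
  ... | yes k≤n = subst Recurrence (ℕₚ.m+[n∸m]≡n k≤n) (above (n ℕ.∸ suc i))
    where
    open ≡-Reasoning
    Recurrence : ℕ → Set
    Recurrence m = divFactor i c f m ≡ f m + c * shift (suc i) (divFactor i c f) m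
    above : ∀ r → Recurrence (suc i ℕ.+ r)
    above r = begin
        divFactor i c f m
      ≡⟨ cong (λ q → ∑ (upTo (suc q)) term) m/k ⟩
        ∑ (upTo (suc (suc (r / suc i)))) term
      ≡⟨ ∑-upTo-suc (suc (r / suc i)) term ⟩
        term 0 + ∑ (upTo (suc (r / suc i))) (term ∘ suc)
      ≡⟨ cong₂ _+_ (ℤₚ.*-identityˡ (f m)) (∑-cong (upTo (suc (r / suc i))) later-term) ⟩
        f m + ∑ (upTo (suc (r / suc i))) (λ j → c * (c ^ j * f (r ℕ.∸ j ℕ.* suc i)))
      ≡⟨ cong (_+_ (f m)) (∑-*ˡ (upTo (suc (r / suc i))) c (λ j → c ^ j * f (r ℕ.∸ j ℕ.* suc i))) ⟩
        f m + c * divFactor i c f r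
      ≡⟨ cong (λ s → f m + c * s) (sym (shift-above (suc i) (divFactor i c f) r)) ⟩
        f m + c * shift (suc i) (divFactor i c f) m
      ∎
      where
      m = suc i ℕ.+ r
      term : ℕ → ℤ
      term j = c ^ j * f (m ℕ.∸ j ℕ.* suc i)
      m/k : m / suc i ≡ suc (r / suc i)
      m/k = trans (m/n≡1+[m∸n]/n (ℕₚ.m≤m+n (suc i) r))
                  (cong (λ x → suc (x / suc i)) (ℕₚ.m+n∸m≡n (suc i) r))
      later-term : ∀ j → term (suc j) ≡ c * (c ^ j * f (r ℕ.∸ j ℕ.* suc i))
      later-term j = trans (ℤₚ.*-assoc c (c ^ j) _)
                           (cong (λ x → c * (c ^ j * f x)) (ℕₚ.[m+n]∸[m+o]≡n∸o (suc i) r (j ℕ.* suc i)))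

  divFactor-unique : ∀ i c f {Y} → (∀ n → Y n ≡ f n + c * shift (suc i) Y n) → Y ≗ divFactor i c f
  divFactor-unique i c f {Y} Y-rec = <-rec (λ n → Y n ≡ divFactor i c f n) step
    where
    step : ∀ n → (∀ {m} → m ℕ.< n → Y m ≡ divFactor i c f m) → Y n ≡ divFactor i c f n
    step n ih = trans (Y-rec n) (trans (cong (λ s → f n + c * s) (shift-strictly-local i n ih))
                                       (sym (divFactor-recurrence i c f n)))

  mulFactor-divFactor : ∀ i c f → mulFactor i c (divFactor i c f) ≗ f
  mulFactor-divFactor i c f n =
    trans (cong (_- c * shift (suc i) (divFactor i c f) n) (divFactor-recurrence i c f n)) (cancel (f n) _)
    where
    cancel : ∀ x y → (x + y) - y ≡ x
    cancel = solve-∀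

  divFactor-mulFactor : ∀ i c Y → divFactor i c (mulFactor i c Y) ≗ Y
  divFactor-mulFactor i c Y n = sym (divFactor-unique i c (mulFactor i c Y) (λ m → uncancel (Y m) _) n)
    where
    uncancel : ∀ x y → x ≡ (x - y) + y
    uncancel = solve-∀

  divFactor-zero : ∀ i f → divFactor i 0ℤ f ≗ f
  divFactor-zero i f n =
    trans (divFactor-recurrence i 0ℤ f n)
          (trans (cong (_+_ (f n)) (ℤₚ.*-zeroˡ (shift (suc i) (divFactor i 0ℤ f) n))) (ℤₚ.+-identityʳ (f n)))

  shift-mulFactor : ∀ j k d Y n → shift j (mulFactor k d Y) n ≡ shift j Y n - d * shift (j ℕ.+ suc k) Y n
  shift-mulFactor zero    k d Y n       = refl
  shift-mulFactor (suc j) k d Y zero    = sym (cong (_-_ 0ℤ) (ℤₚ.*-zeroʳ d))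
  shift-mulFactor (suc j) k d Y (suc n) = shift-mulFactor j k d Y n

  mulFactor-comm : ∀ i c k d Y → mulFactor i c (mulFactor k d Y) ≗ mulFactor k d (mulFactor i c Y)
  mulFactor-comm i c k d Y n = begin
      mulFactor k d Y n - c * shift (suc i) (mulFactor k d Y) n
    ≡⟨ cong (λ s → mulFactor k d Y n - c * s) (shift-mulFactor (suc i) k d Y n) ⟩
      (Y n - d * Sₖ) - c * (Sᵢ - d * shift (suc i ℕ.+ suc k) Y n)
    ≡⟨ cong (λ e → (Y n - d * Sₖ) - c * (Sᵢ - d * shift e Y n)) (ℕₚ.+-comm (suc i) (suc k)) ⟩
      (Y n - d * Sₖ) - c * (Sᵢ - d * shift (suc k ℕ.+ suc i) Y n)
    ≡⟨ exchange (Y n) Sᵢ Sₖ (shift (suc k ℕ.+ suc i) Y n) c d ⟩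
      (Y n - c * Sᵢ) - d * (Sₖ - c * shift (suc k ℕ.+ suc i) Y n)
    ≡⟨ cong (λ s → mulFactor i c Y n - d * s) (sym (shift-mulFactor (suc k) i c Y n)) ⟩
      mulFactor i c Y n - d * shift (suc k) (mulFactor i c Y) n
    ∎
    where
    open ≡-Reasoning
    Sᵢ = shift (suc i) Y n
    Sₖ = shift (suc k) Y n
    exchange : ∀ y a b e c d → (y - d * b) - c * (a - d * e) ≡ (y - c * a) - d * (b - c * e)
    exchange = solve-∀

  mulFactor-conjugate : ∀ i c Y → mulFactor i c (mulFactor i (- c) Y) ≗ mulFactor (i ℕ.+ suc i) (c * c) Y
  mulFactor-conjugate i c Y n =
    trans (cong (λ s → mulFactor i (- c) Y n - c * s) (shift-mulFactor (suc i) i (- c) Y n))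
          (collapse (Y n) (shift (suc i) Y n) (shift (suc i ℕ.+ suc i) Y n) c)
    where
    collapse : ∀ y a e c → (y - (- c) * a) - c * (a - (- c) * e) ≡ y - (c * c) * e
    collapse = solve-∀

  divFactor-intertwine : ∀ i c d (Φ : Series → Series) → Congruent _≗_ _≗_ Φ →
                         (∀ Y → Φ (mulFactor i c Y) ≗ mulFactor i d (Φ Y)) →
                         ∀ f → Φ (divFactor i c f) ≗ divFactor i d (Φ f)
  divFactor-intertwine i c d Φ Φ-cong Φ-mulFactor f n = begin
      Φ (divFactor i c f) n
    ≡⟨ sym (divFactor-mulFactor i d (Φ (divFactor i c f)) n) ⟩
      divFactor i d (mulFactor i d (Φ (divFactor i c f))) n
    ≡⟨ divFactor-cong i d (λ m → sym (Φ-mulFactor (divFactor i c f) m)) n ⟩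
      divFactor i d (Φ (mulFactor i c (divFactor i c f))) n
    ≡⟨ divFactor-cong i d (Φ-cong (mulFactor-divFactor i c f)) n ⟩
      divFactor i d (Φ f) n
    ∎
    where open ≡-Reasoning

  divFactor-merge : ∀ i a j b k c → (∀ Y → mulFactor i a (mulFactor j b Y) ≗ mulFactor k c Y) →
                    ∀ f → divFactor j b (divFactor i a f) ≗ divFactor k c f
  divFactor-merge i a j b k c product f n = begin
      X n                                              ≡⟨ sym (divFactor-mulFactor k c X n) ⟩
      divFactor k c (mulFactor k c X) n                ≡⟨ divFactor-cong k c (λ m → sym (product X m)) n ⟩
      divFactor k c (mulFactor i a (mulFactor j b X)) n
        ≡⟨ divFactor-cong k c (mulFactor-cong i a (mulFactor-divFactor j b (divFactor i a f))) n ⟩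
      divFactor k c (mulFactor i a (divFactor i a f)) n ≡⟨ divFactor-cong k c (mulFactor-divFactor i a f) n ⟩
      divFactor k c f n                                ∎
    where
    open ≡-Reasoning
    X = divFactor j b (divFactor i a f)

  -- Convolution and the substitution q ↦ −q

  conv : Series → Series → Series
  conv f g n = ∑ (upTo (suc n)) (λ i → f i * g (n ℕ.∸ i))

  _≗[≤_]_ : Series → ℕ → Series → Set
  F ≗[≤ n ] G = ∀ {m} → m ℕ.≤ n → F m ≡ G m

  conv-agree : ∀ {n f f′ g g′} → f ≗[≤ n ] f′ → g ≗[≤ n ] g′ → conv f g ≗[≤ n ] conv f′ g′
  conv-agree f≗f′ g≗g′ {m} m≤n = ∑-cong-∈ (upTo (suc m)) λ {i} i∈ →
    cong₂ _*_ (f≗f′ (ℕₚ.≤-trans (ℕₚ.≤-pred (∈-upTo⁻ i∈)) m≤n))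
              (g≗g′ (ℕₚ.≤-trans (ℕₚ.m∸n≤m m i) m≤n))

  conv-congˡ : ∀ g → Congruent _≗_ _≗_ (λ f → conv f g)
  conv-congˡ g f≗f′ n = ∑-cong (upTo (suc n)) (λ i → cong (_* g (n ℕ.∸ i)) (f≗f′ i))

  conv-δ : ∀ g → conv δ g ≗ g
  conv-δ g n = begin
      conv δ g n
    ≡⟨ ∑-upTo-suc n (λ i → δ i * g (n ℕ.∸ i)) ⟩
      1ℤ * g n + ∑ (upTo n) (λ i → 0ℤ * g (n ℕ.∸ suc i))
    ≡⟨ cong₂ _+_ (ℤₚ.*-identityˡ (g n)) (∑-*ˡ (upTo n) 0ℤ (λ i → g (n ℕ.∸ suc i))) ⟩
      g n + 0ℤ * ∑ (upTo n) (λ i → g (n ℕ.∸ suc i))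
    ≡⟨ cong (_+_ (g n)) (ℤₚ.*-zeroˡ (∑ (upTo n) (λ i → g (n ℕ.∸ suc i)))) ⟩
      g n + 0ℤ
    ≡⟨ ℤₚ.+-identityʳ (g n) ⟩
      g n
    ∎
    where open ≡-Reasoning

  conv-shift : ∀ k F g → conv (shift k F) g ≗ shift k (conv F g)
  conv-shift zero    F g n       = refl
  conv-shift (suc k) F g zero    = trans (ℤₚ.+-identityʳ _) (ℤₚ.*-zeroˡ (g 0))
  conv-shift (suc k) F g (suc n) =
    trans (∑-upTo-suc (suc n) (λ i → shift (suc k) F i * g (suc n ℕ.∸ i)))
          (trans (cong (_+ conv (shift k F) g n) (ℤₚ.*-zeroˡ (g (suc n))))
                 (trans (ℤₚ.+-identityˡ _) (conv-shift k F g n)))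

  conv-mulFactor : ∀ i c F g → conv (mulFactor i c F) g ≗ mulFactor i c (conv F g)
  conv-mulFactor i c F g n = begin
      conv (mulFactor i c F) g n
    ≡⟨ ∑-cong (upTo (suc n)) (λ j → distrib (F j) (shift (suc i) F j) (g (n ℕ.∸ j)) c) ⟩
      ∑ (upTo (suc n)) (λ j → F j * g (n ℕ.∸ j) - c * (shift (suc i) F j * g (n ℕ.∸ j)))
    ≡⟨ ∑-linear (upTo (suc n)) (λ j → F j * g (n ℕ.∸ j)) (λ j → shift (suc i) F j * g (n ℕ.∸ j)) c ⟩
      conv F g n - c * conv (shift (suc i) F) g n
    ≡⟨ cong (λ s → conv F g n - c * s) (conv-shift (suc i) F g n) ⟩
      mulFactor i c (conv F g) n
    ∎
    where
    open ≡-Reasoning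
    distrib : ∀ a b x c → (a - c * b) * x ≡ a * x - c * (b * x)
    distrib = solve-∀

  -- twist F is F(−q).
  twist : Series → Series
  twist F n = -1ℤ ^ n * F n

  twist-cong : Congruent _≗_ _≗_ twist
  twist-cong F≗G n = cong (-1ℤ ^ n *_) (F≗G n)

  twist-δ : twist δ ≗ δ
  twist-δ zero    = refl
  twist-δ (suc n) = ℤₚ.*-zeroʳ (-1ℤ ^ suc n)

  -1^-squared : ∀ k → -1ℤ ^ k * -1ℤ ^ k ≡ 1ℤ
  -1^-squared zero    = refl
  -1^-squared (suc k) = trans (negate-twice (-1ℤ ^ k)) (-1^-squared k)
    where
    negate-twice : ∀ a → (-1ℤ * a) * (-1ℤ * a) ≡ a * a
    negate-twice = solve-∀

  twist-shift : ∀ k F n → shift k (twist F) n ≡ -1ℤ ^ n * (-1ℤ ^ k * shift k F n)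
  twist-shift zero    F n       = cong (-1ℤ ^ n *_) (sym (ℤₚ.*-identityˡ (F n)))
  twist-shift (suc k) F zero    = sym (trans (ℤₚ.*-identityˡ _) (ℤₚ.*-zeroʳ (-1ℤ ^ suc k)))
  twist-shift (suc k) F (suc n) = trans (twist-shift k F n) (negate-both (-1ℤ ^ n) (-1ℤ ^ k) (shift k F n))
    where
    negate-both : ∀ a b x → a * (b * x) ≡ (-1ℤ * a) * ((-1ℤ * b) * x)
    negate-both = solve-∀

  twist-mulFactor : ∀ i c Y → twist (mulFactor i c Y) ≗ mulFactor i (c * -1ℤ ^ suc i) (twist Y)
  twist-mulFactor i c Y n = begin
      s * (Y n - c * S)
    ≡⟨ expand s (Y n) c S ⟩
      s * Y n - c * (s * S)
    ≡⟨ cong (λ x → s * Y n - x) (sym (ℤₚ.*-identityʳ (c * (s * S)))) ⟩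
      s * Y n - (c * (s * S)) * 1ℤ
    ≡⟨ cong (λ x → s * Y n - (c * (s * S)) * x) (sym (-1^-squared (suc i))) ⟩
      s * Y n - (c * (s * S)) * (t * t)
    ≡⟨ cong (λ x → s * Y n - x) (sym (regroup c t s S)) ⟩
      s * Y n - (c * t) * (s * (t * S))
    ≡⟨ cong (λ x → s * Y n - (c * t) * x) (sym (twist-shift (suc i) Y n)) ⟩
      mulFactor i (c * t) (twist Y) n
    ∎
    where
    open ≡-Reasoning
    s = -1ℤ ^ n
    t = -1ℤ ^ suc i
    S = shift (suc i) Y n
    expand : ∀ s y c z → s * (y - c * z) ≡ s * y - c * (s * z)
    expand = solve-∀
    regroup : ∀ c t s z → (c * t) * (s * (t * z)) ≡ (c * (s * z)) * (t * t)
    regroup = solve-∀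

  divFactors : (ℕ → ℤ) → ℕ → Series → Series
  divFactors a zero    X = X
  divFactors a (suc K) X = divFactor K (a K) (divFactors a K X)

  divFactors-cong : ∀ a K → Congruent _≗_ _≗_ (divFactors a K)
  divFactors-cong a zero    X≗Y = X≗Y
  divFactors-cong a (suc K) X≗Y = divFactor-cong K (a K) (divFactors-cong a K X≗Y)

  divFactors-intertwine : ∀ a b (Φ : Series → Series) → Congruent _≗_ _≗_ Φ →
                          (∀ i Y → Φ (mulFactor i (a i) Y) ≗ mulFactor i (b i) (Φ Y)) →
                          ∀ K X → Φ (divFactors a K X) ≗ divFactors b K (Φ X)
  divFactors-intertwine a b Φ Φ-cong Φ-mulFactor zero    X n = refl
  divFactors-intertwine a b Φ Φ-cong Φ-mulFactor (suc K) X n =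
    trans (divFactor-intertwine K (a K) (b K) Φ Φ-cong (Φ-mulFactor K) (divFactors a K X) n)
          (divFactor-cong K (b K) (divFactors-intertwine a b Φ Φ-cong Φ-mulFactor K X) n)

  conv-divFactors : ∀ a K g F → conv (divFactors a K F) g ≗ divFactors a K (conv F g)
  conv-divFactors a K g =
    divFactors-intertwine a a (λ F → conv F g) (conv-congˡ g) (λ i Y → conv-mulFactor i (a i) Y g) K

  twistCoeff : (ℕ → ℤ) → ℕ → ℤ
  twistCoeff a i = a i * -1ℤ ^ suc i

  twist-divFactors : ∀ a K X → twist (divFactors a K X) ≗ divFactors (twistCoeff a) K (twist X)
  twist-divFactors a = divFactors-intertwine a (twistCoeff a) twist twist-cong (λ i → twist-mulFactor i (a i))

  divFactor-divFactors : ∀ i c a K X → divFactor i c (divFactors a K X) ≗ divFactors a K (divFactor i c X)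
  divFactor-divFactors i c a = divFactors-intertwine a a (divFactor i c) (divFactor-cong i c) commute
    where
    commute : ∀ k Y → divFactor i c (mulFactor k (a k) Y) ≗ mulFactor k (a k) (divFactor i c Y)
    commute k Y n =
      sym (divFactor-intertwine i c c (mulFactor k (a k)) (mulFactor-cong k (a k)) (mulFactor-comm k (a k) i c) Y n)

  -- Positivity

  Dominating : (Series → Series) → Set
  Dominating Φ = ∀ {Y} → Nonneg Y → ∀ n → Y n ≤ Φ Y n

  dominating-nonneg : ∀ {Φ} → Dominating Φ → ∀ {Y} → Nonneg Y → Nonneg (Φ Y)
  dominating-nonneg dominating nonneg n = ℤₚ.≤-trans (nonneg n) (dominating nonneg n)

  divFactor-one-dominating : ∀ i → Dominating (divFactor i 1ℤ)
  divFactor-one-dominating i {f} nonneg n = begin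
      f n                                 ≡⟨ sym (ℤₚ.*-identityˡ (f n)) ⟩
      1ℤ * f n                            ≤⟨ ℤₚ.i≤i+j _ _ {{nonNegative (∑-nonneg (upTo q) later-nonneg)}} ⟩
      1ℤ * f n + ∑ (upTo q) (term ∘ suc)  ≡⟨ sym (∑-upTo-suc q term) ⟩
      divFactor i 1ℤ f n                  ∎
    where
    open ℤₚ.≤-Reasoning
    q = n / suc i
    term : ℕ → ℤ
    term j = 1ℤ ^ j * f (n ℕ.∸ j ℕ.* suc i)
    later-nonneg : ∀ j → 0ℤ ≤ term (suc j)
    later-nonneg j =
      subst (0ℤ ≤_) (sym (trans (cong (_* f m) (ℤₚ.^-zeroˡ (suc j))) (ℤₚ.*-identityˡ (f m)))) (nonneg m)
      where m = n ℕ.∸ suc j ℕ.* suc i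

  divFactor₀-≥-constant-term : ∀ {f} → Nonneg f → ∀ n → f 0 ≤ divFactor 0 1ℤ f n
  divFactor₀-≥-constant-term nonneg zero    = divFactor-one-dominating 0 nonneg 0
  divFactor₀-≥-constant-term {f} nonneg (suc n) = begin
      f 0                      ≤⟨ divFactor₀-≥-constant-term nonneg n ⟩
      D n                      ≤⟨ ℤₚ.i≤j+i _ _ {{nonNegative (nonneg (suc n))}} ⟩
      f (suc n) + D n          ≡⟨ cong (_+_ (f (suc n))) (sym (ℤₚ.*-identityˡ (D n))) ⟩
      f (suc n) + 1ℤ * D n     ≡⟨ sym (divFactor-recurrence 0 1ℤ f (suc n)) ⟩
      D (suc n)                ∎
    where
    open ℤₚ.≤-Reasoning
    D = divFactor 0 1ℤ f

  data PositivePair : ℤ → ℤ → Set where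
    geometric  : PositivePair 1ℤ 0ℤ
    minus-plus : PositivePair -1ℤ 1ℤ
    plus-minus : PositivePair 1ℤ -1ℤ

  -- 1 / ((1 ± q^k)(1 ∓ q^k)) = 1 / (1 - q^(2k))
  pair-dominating : ∀ {a b} → PositivePair a b → ∀ i → Dominating (divFactor i a ∘ divFactor i b)
  pair-dominating geometric i {Y} nonneg n =
    ℤₚ.≤-trans (divFactor-one-dominating i nonneg n)
               (ℤₚ.≤-reflexive (divFactor-cong i 1ℤ (λ m → sym (divFactor-zero i Y m)) n))
  pair-dominating minus-plus i {Y} nonneg n =
    ℤₚ.≤-trans (divFactor-one-dominating (i ℕ.+ suc i) nonneg n)
               (ℤₚ.≤-reflexive (sym (divFactor-merge i 1ℤ i -1ℤ (i ℕ.+ suc i) 1ℤ (mulFactor-conjugate i 1ℤ) Y n)))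
  pair-dominating plus-minus i {Y} nonneg n =
    ℤₚ.≤-trans (divFactor-one-dominating (i ℕ.+ suc i) nonneg n)
               (ℤₚ.≤-reflexive (sym (divFactor-merge i -1ℤ i 1ℤ (i ℕ.+ suc i) 1ℤ (mulFactor-conjugate i -1ℤ) Y n)))

  pairs : (ℕ → ℤ) → (ℕ → ℤ) → ℕ → Series → Series
  pairs a b K = divFactors a K ∘ divFactors b K

  pairs-cong : ∀ a b K → Congruent _≗_ _≗_ (pairs a b K)
  pairs-cong a b K = divFactors-cong a K ∘ divFactors-cong b K

  twist-pairs : ∀ a b K Y → twist (pairs a b K Y) ≗ pairs (twistCoeff a) (twistCoeff b) K (twist Y)
  twist-pairs a b K Y n =
    trans (twist-divFactors a K (divFactors b K Y) n) (divFactors-cong (twistCoeff a) K (twist-divFactors b K Y) n)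

  module _ {a b : ℕ → ℤ} (positive : ∀ i → PositivePair (a i) (b i)) where

    pairs-step-≥ : ∀ K {Y} → Nonneg (pairs a b K Y) → ∀ n → pairs a b K Y n ≤ pairs a b (suc K) Y n
    pairs-step-≥ K {Y} nonneg n = begin
        Z n
      ≤⟨ pair-dominating (positive K) K nonneg n ⟩
        divFactor K (a K) (divFactor K (b K) Z) n
      ≡⟨ divFactor-cong K (a K) (divFactor-divFactors K (b K) a K (divFactors b K Y)) n ⟩
        pairs a b (suc K) Y n
      ∎
      where
      open ℤₚ.≤-Reasoning
      Z = pairs a b K Y

    pairs-dominating : ∀ K → Dominating (pairs a b K)
    pairs-dominating zero    nonneg n = ℤₚ.≤-refl
    pairs-dominating (suc K) nonneg n =
      ℤₚ.≤-trans (pairs-dominating K nonneg n) (pairs-step-≥ K (dominating-nonneg (pairs-dominating K) nonneg) n)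

    pairs-≥-constant-term : a 0 ≡ 1ℤ → b 0 ≡ 0ℤ → ∀ K {Y} → Nonneg Y → ∀ n → Y 0 ≤ pairs a b (suc K) Y n
    pairs-≥-constant-term a₀ b₀ zero {Y} nonneg n = begin
        Y 0                                  ≤⟨ divFactor₀-≥-constant-term nonneg n ⟩
        divFactor 0 1ℤ Y n                   ≡⟨ divFactor-cong 0 1ℤ (λ m → sym (divFactor-zero 0 Y m)) n ⟩
        divFactor 0 1ℤ (divFactor 0 0ℤ Y) n  ≡⟨ cong₂ (λ x y → divFactor 0 x (divFactor 0 y Y) n) (sym a₀) (sym b₀) ⟩
        pairs a b 1 Y n                      ∎
      where open ℤₚ.≤-Reasoning
    pairs-≥-constant-term a₀ b₀ (suc K) nonneg n =
      ℤₚ.≤-trans (pairs-≥-constant-term a₀ b₀ K nonneg n)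
                 (pairs-step-≥ (suc K) (dominating-nonneg (pairs-dominating (suc K)) nonneg) n)

  -- Partition generating functions

  lengthWeight : ℤ → List ℕ → ℤ
  lengthWeight c ps = c ^ length ps

  partitionSeries : (ℕ → Bool) → ℤ → ℕ → Series
  partitionSeries ok c k n = ∑ (partsUpTo ok k n) (lengthWeight c)

  factorCoeff : (ℕ → Bool) → ℤ → ℕ → ℤ
  factorCoeff ok c i = if ok (suc i) then c else 0ℤ

  lengthWeight-replicate-++ : ∀ c m x ps → lengthWeight c (replicate m x ++ ps) ≡ c ^ m * lengthWeight c ps
  lengthWeight-replicate-++ c m x ps =
    trans (cong (c ^_) (trans (length-++ (replicate m x)) (cong (ℕ._+ length ps) (length-replicate m))))
          (ℤₚ.^-distribˡ-+-* c m (length ps))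

  partitionSeries-step : ∀ ok c k →
                         partitionSeries ok c (suc k) ≗ divFactor k (factorCoeff ok c k) (partitionSeries ok c k)
  partitionSeries-step ok c k n =
    trans (∑-concatMap withMultiplicity (multiplicities (ok (suc k))) (lengthWeight c))
          (trans (∑-cong (multiplicities (ok (suc k))) weigh) (byAdmissibility (ok (suc k))))
    where
    P = partitionSeries ok c k
    remaining : ℕ → ℕ
    remaining m = n ℕ.∸ m ℕ.* suc k
    withMultiplicity : ℕ → List (List ℕ)
    withMultiplicity m = map (replicate m (suc k) ++_) (partsUpTo ok k (remaining m))
    multiplicities : Bool → List ℕ
    multiplicities b = if b then upTo (suc (n / suc k)) else (0 ∷ [])
    weigh : ∀ m → ∑ (withMultiplicity m) (lengthWeight c) ≡ c ^ m * P (remaining m)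
    weigh m = trans (∑-map (replicate m (suc k) ++_) (partsUpTo ok k (remaining m)) (lengthWeight c))
                    (trans (∑-cong (partsUpTo ok k (remaining m)) (lengthWeight-replicate-++ c m (suc k)))
                           (∑-*ˡ (partsUpTo ok k (remaining m)) (c ^ m) (lengthWeight c)))
    byAdmissibility : ∀ b → ∑ (multiplicities b) (λ m → c ^ m * P (remaining m)) ≡
                            divFactor k (if b then c else 0ℤ) P n
    byAdmissibility true  = refl
    byAdmissibility false = trans (trans (ℤₚ.+-identityʳ _) (ℤₚ.*-identityˡ (P n))) (sym (divFactor-zero k P n))

  partitionSeries-zero : ∀ ok c → partitionSeries ok c 0 ≗ δ
  partitionSeries-zero ok c zero    = refl
  partitionSeries-zero ok c (suc n) = refl

  partitionSeries-divFactors : ∀ ok c K → partitionSeries ok c K ≗ divFactors (factorCoeff ok c) K δ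
  partitionSeries-divFactors ok c zero    = partitionSeries-zero ok c
  partitionSeries-divFactors ok c (suc K) n =
    trans (partitionSeries-step ok c K n) (divFactor-cong K (factorCoeff ok c K) (partitionSeries-divFactors ok c K) n)

  partitionSeries-stable : ∀ ok c K → (λ n → partitionSeries ok c n n) ≗[≤ K ] partitionSeries ok c K
  partitionSeries-stable ok c K n≤K = sym (stable (ℕₚ.≤⇒≤′ n≤K))
    where
    stable : ∀ {n K} → n ≤′ K → partitionSeries ok c K n ≡ partitionSeries ok c n n
    stable ≤′-refl                  = refl
    stable {n} (≤′-step {K} n≤′K) =
      trans (partitionSeries-step ok c K n)
            (trans (divFactor-below K (factorCoeff ok c K) (partitionSeries ok c K) (s≤s (ℕₚ.≤′⇒≤ n≤′K)))
                   (stable n≤′K))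

  conv-partitionSeries : ∀ ok c K G → conv (partitionSeries ok c K) G ≗ divFactors (factorCoeff ok c) K G
  conv-partitionSeries ok c K G n =
    trans (conv-congˡ G (partitionSeries-divFactors ok c K) n)
          (trans (conv-divFactors (factorCoeff ok c) K G δ n) (divFactors-cong (factorCoeff ok c) K (conv-δ G) n))


  quadWeight : (List ℕ → ℤ) → (List ℕ → ℤ) → Quad → ℤ
  quadWeight u v (α₁ , β₁ , α₂ , β₂) = ((u α₁ * v β₁) * u α₂) * v β₂

  ∑-quadruples : ∀ u v (La Lb Lc Ld : List (List ℕ)) →
    ∑ (concatMap (λ α₁ → concatMap (λ β₁ → concatMap (λ α₂ → map (λ β₂ → (α₁ , β₁ , α₂ , β₂))
                 Ld) Lc) Lb) La) (quadWeight u v)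
    ≡ ∑ La u * (∑ Lb v * (∑ Lc u * ∑ Ld v))
  ∑-quadruples u v La Lb Lc Ld =
    trans (∑-concatMap from₁ La W) (trans (∑-cong La sum₁) (∑-*ʳ La u _))
    where
    W = quadWeight u v
    from₃ : List ℕ → List ℕ → List ℕ → List Quad
    from₃ α₁ β₁ α₂ = map (λ β₂ → (α₁ , β₁ , α₂ , β₂)) Ld
    from₂ : List ℕ → List ℕ → List Quad
    from₂ α₁ β₁ = concatMap (from₃ α₁ β₁) Lc
    from₁ : List ℕ → List Quad
    from₁ α₁ = concatMap (from₂ α₁) Lb
    sum₃ : ∀ α₁ β₁ α₂ → ∑ (from₃ α₁ β₁ α₂) W ≡ ((u α₁ * v β₁) * u α₂) * ∑ Ld v
    sum₃ α₁ β₁ α₂ = trans (∑-map (λ β₂ → (α₁ , β₁ , α₂ , β₂)) Ld W) (∑-*ˡ Ld ((u α₁ * v β₁) * u α₂) v)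
    sum₂ : ∀ α₁ β₁ → ∑ (from₂ α₁ β₁) W ≡ (u α₁ * v β₁) * (∑ Lc u * ∑ Ld v)
    sum₂ α₁ β₁ = trans (∑-concatMap (from₃ α₁ β₁) Lc W)
                       (trans (∑-cong Lc (sum₃ α₁ β₁)) (∑-*-* Lc (u α₁ * v β₁) u (∑ Ld v)))
    sum₁ : ∀ α₁ → ∑ (from₁ α₁) W ≡ u α₁ * (∑ Lb v * (∑ Lc u * ∑ Ld v))
    sum₁ α₁ = trans (∑-concatMap (from₂ α₁) Lb W)
                    (trans (∑-cong Lb (sum₂ α₁)) (∑-*-* Lb (u α₁) v (∑ Lc u * ∑ Ld v)))

  weightedCount : (ℕ → List (List ℕ)) → (List ℕ → ℤ) → Series
  weightedCount family w n = ∑ (family n) w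

  ∑-quads : ∀ u v n → ∑ (quads n) (quadWeight u v) ≡
    conv (weightedCount partitions u)
         (conv (weightedCount partitionsNot±1mod6 v)
               (conv (weightedCount partitions u) (weightedCount partitionsNot±1mod6 v))) n
  ∑-quads u v n = trans (∑-concatMap withA (upTo (suc n)) W) (∑-cong (upTo (suc n)) sumA)
    where
    W = quadWeight u v
    U = weightedCount partitions u
    V = weightedCount partitionsNot±1mod6 v
    withABC : ℕ → ℕ → ℕ → List Quad
    withABC a b c = concatMap (λ α₁ → concatMap (λ β₁ → concatMap (λ α₂ → map (λ β₂ → (α₁ , β₁ , α₂ , β₂))
                      (partitionsNot±1mod6 (n ℕ.∸ a ℕ.∸ b ℕ.∸ c))) (partitions c)) (partitionsNot±1mod6 b)) (partitions a)
    withAB : ℕ → ℕ → List Quad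
    withAB a b = concatMap (withABC a b) (upTo (suc (n ℕ.∸ a ℕ.∸ b)))
    withA : ℕ → List Quad
    withA a = concatMap (withAB a) (upTo (suc (n ℕ.∸ a)))
    sumAB : ∀ a b → ∑ (withAB a b) W ≡ U a * (V b * conv U V (n ℕ.∸ a ℕ.∸ b))
    sumAB a b = begin
        ∑ (withAB a b) W
      ≡⟨ ∑-concatMap (withABC a b) cs W ⟩
        ∑ cs (λ c → ∑ (withABC a b c) W)
      ≡⟨ ∑-cong cs (λ c → ∑-quadruples u v (partitions a) (partitionsNot±1mod6 b) (partitions c)
                                            (partitionsNot±1mod6 (n ℕ.∸ a ℕ.∸ b ℕ.∸ c))) ⟩
        ∑ cs (λ c → U a * (V b * (U c * V (n ℕ.∸ a ℕ.∸ b ℕ.∸ c))))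
      ≡⟨ ∑-*ˡ cs (U a) _ ⟩
        U a * ∑ cs (λ c → V b * (U c * V (n ℕ.∸ a ℕ.∸ b ℕ.∸ c)))
      ≡⟨ cong (U a *_) (∑-*ˡ cs (V b) _) ⟩
        U a * (V b * conv U V (n ℕ.∸ a ℕ.∸ b))
      ∎
      where
      open ≡-Reasoning
      cs = upTo (suc (n ℕ.∸ a ℕ.∸ b))
    sumA : ∀ a → ∑ (withA a) W ≡ U a * conv V (conv U V) (n ℕ.∸ a)
    sumA a = trans (∑-concatMap (withAB a) bs W) (trans (∑-cong bs (sumAB a)) (∑-*ˡ bs (U a) _))
      where
      bs = upTo (suc (n ℕ.∸ a))

  -- Parity of the pd-crank

  crankSign : Quad → ℤ
  crankSign = quadWeight (lengthWeight -1ℤ) (lengthWeight 1ℤ)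

  crankSign-lengths : ∀ α₁ β₁ α₂ β₂ → crankSign (α₁ , β₁ , α₂ , β₂) ≡ -1ℤ ^ (length α₁ ℕ.+ length α₂)
  crankSign-lengths α₁ β₁ α₂ β₂ = begin
      ((s₁ * 1ℤ ^ length β₁) * s₂) * 1ℤ ^ length β₂
    ≡⟨ cong₂ (λ x y → ((s₁ * x) * s₂) * y) (ℤₚ.^-zeroˡ (length β₁)) (ℤₚ.^-zeroˡ (length β₂)) ⟩
      ((s₁ * 1ℤ) * s₂) * 1ℤ
    ≡⟨ trans (ℤₚ.*-identityʳ _) (cong (_* s₂) (ℤₚ.*-identityʳ s₁)) ⟩
      s₁ * s₂
    ≡⟨ sym (ℤₚ.^-distribˡ-+-* -1ℤ (length α₁) (length α₂)) ⟩
      -1ℤ ^ (length α₁ ℕ.+ length α₂)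
    ∎
    where
    open ≡-Reasoning
    s₁ = -1ℤ ^ length α₁
    s₂ = -1ℤ ^ length α₂

  %2-suc-suc : ∀ n → suc (suc n) % 2 ≡ n % 2
  %2-suc-suc n = trans (cong (_% 2) (ℕₚ.+-comm 2 n)) ([m+n]%n≡m%n n 2)

  parity : ∀ n → (n % 2 ≡ 0 × suc n % 2 ≡ 1 × -1ℤ ^ n ≡ 1ℤ) ⊎ (n % 2 ≡ 1 × suc n % 2 ≡ 0 × -1ℤ ^ n ≡ -1ℤ)
  parity zero = inj₁ (refl , refl , refl)
  parity (suc n) with parity n
  ... | inj₁ (n-even , sn-odd , sign) = inj₂ (sn-odd , trans (%2-suc-suc n) n-even , cong (-1ℤ *_) sign)
  ... | inj₂ (n-odd , sn-even , sign) = inj₁ (sn-even , trans (%2-suc-suc n) n-odd , cong (-1ℤ *_) sign)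

  ⊖-%2 : ∀ a b → (a ⊖ b) %ℕ 2 ≡ (a ℕ.+ b) % 2
  ⊖-%2 a       zero    = cong (_% 2) (sym (ℕₚ.+-identityʳ a))
  ⊖-%2 zero    (suc b) with suc b % 2 | m%n<n (suc b) 2
  ... | 0 | _ = refl
  ... | 1 | _ = refl
  ... | suc (suc _) | s≤s (s≤s ())
  ⊖-%2 (suc a) (suc b) = begin
      (suc a ⊖ suc b) %ℕ 2   ≡⟨ cong (_%ℕ 2) (ℤₚ.[1+m]⊖[1+n]≡m⊖n a b) ⟩
      (a ⊖ b) %ℕ 2           ≡⟨ ⊖-%2 a b ⟩
      (a ℕ.+ b) % 2          ≡⟨ sym (%2-suc-suc (a ℕ.+ b)) ⟩
      suc (suc (a ℕ.+ b)) % 2 ≡⟨ cong (λ x → suc x % 2) (sym (ℕₚ.+-suc a b)) ⟩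
      (suc a ℕ.+ suc b) % 2   ∎
    where open ≡-Reasoning

  crank-%2 : ∀ a b k → ((+ a - + b) - + k) %ℕ 2 ≡ (k ℕ.+ (a ℕ.+ b)) % 2
  crank-%2 a b k = begin
      ((+ a - + b) - + k) %ℕ 2    ≡⟨ cong (_%ℕ 2) (regroup (+ a) (+ b) (+ k)) ⟩
      (+ a - (+ b + + k)) %ℕ 2    ≡⟨ cong (_%ℕ 2) (ℤₚ.m-n≡m⊖n a (b ℕ.+ k)) ⟩
      (a ⊖ (b ℕ.+ k)) %ℕ 2        ≡⟨ ⊖-%2 a (b ℕ.+ k) ⟩
      (a ℕ.+ (b ℕ.+ k)) % 2       ≡⟨ cong (_% 2) (trans (sym (ℕₚ.+-assoc a b k)) (ℕₚ.+-comm (a ℕ.+ b) k)) ⟩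
      (k ℕ.+ (a ℕ.+ b)) % 2       ∎
    where
    open ≡-Reasoning
    regroup : ∀ x y z → (x - y) - z ≡ x - (y + z)
    regroup = solve-∀

  count-difference : ∀ {P Q : A → Set} (P? : Decidable P) (Q? : Decidable Q) (w : A → ℤ) →
                     (∀ x → (P x × ¬ Q x × w x ≡ 1ℤ) ⊎ (¬ P x × Q x × w x ≡ -1ℤ)) →
                     ∀ xs → + length (filter P? xs) - + length (filter Q? xs) ≡ ∑ xs w
  count-difference P? Q? w classify []       = refl
  count-difference P? Q? w classify (x ∷ xs) with classify x
  ... | inj₁ (p , ¬q , w≡1) rewrite filter-accept P? {x} {xs} p | filter-reject Q? {x} {xs} ¬q | w≡1 =
    trans (shift-out (+ length (filter P? xs)) (+ length (filter Q? xs)))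
          (cong (_+_ 1ℤ) (count-difference P? Q? w classify xs))
    where
    shift-out : ∀ a b → (1ℤ + a) - b ≡ 1ℤ + (a - b)
    shift-out = solve-∀
  ... | inj₂ (¬p , q , w≡-1) rewrite filter-reject P? {x} {xs} ¬p | filter-accept Q? {x} {xs} q | w≡-1 =
    trans (shift-out (+ length (filter P? xs)) (+ length (filter Q? xs)))
          (cong (_+_ -1ℤ) (count-difference P? Q? w classify xs))
    where
    shift-out : ∀ a b → a - (1ℤ + b) ≡ -1ℤ + (a - b)
    shift-out = solve-∀

  CrankResidue : ℤ → Quad → Set
  CrankResidue k q = ((pdCrank q - k) %ℕ 2) ≡ 0

  crank-classification : ∀ q → (CrankResidue (+ 0) q × ¬ CrankResidue (+ 1) q × crankSign q ≡ 1ℤ)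
                             ⊎ (¬ CrankResidue (+ 0) q × CrankResidue (+ 1) q × crankSign q ≡ -1ℤ)
  crank-classification (α₁ , β₁ , α₂ , β₂)
    rewrite crank-%2 (length α₁) (length α₂) 0 | crank-%2 (length α₁) (length α₂) 1
          | crankSign-lengths α₁ β₁ α₂ β₂
    with parity (length α₁ ℕ.+ length α₂)
  ... | inj₁ (even , suc-odd , sign) = inj₁ (even , (λ r → ℕₚ.1+n≢0 (trans (sym suc-odd) r)) , sign)
  ... | inj₂ (odd , suc-even , sign) = inj₂ ((λ r → ℕₚ.1+n≢0 (trans (sym odd) r)) , suc-even , sign)

  signedCount : ℕ → ℤ
  signedCount m = + MbdMod (+ 0) 2 m - + MbdMod (+ 1) 2 m

  signedCount≡∑crankSign : ∀ m → signedCount m ≡ ∑ (quads m) crankSign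
  signedCount≡∑crankSign m =
    count-difference (λ q → ((pdCrank q - + 0) %ℕ 2) ℕ.≟ 0) (λ q → ((pdCrank q - + 1) %ℕ 2) ℕ.≟ 0)
                     crankSign crank-classification (quads m)

  -- The signed count

  -1^-even : ∀ n → -1ℤ ^ (2 ℕ.* n) ≡ 1ℤ
  -1^-even n = trans (sym (ℤₚ.^-*-assoc -1ℤ 2 n)) (ℤₚ.^-zeroˡ n)

  -1^-mod-6 : ∀ j → -1ℤ ^ j ≡ -1ℤ ^ (j % 6)
  -1^-mod-6 j = begin
      -1ℤ ^ j                                    ≡⟨ cong (-1ℤ ^_) (m≡m%n+[m/n]*n j 6) ⟩
      -1ℤ ^ (j % 6 ℕ.+ j / 6 ℕ.* 6)              ≡⟨ ℤₚ.^-distribˡ-+-* -1ℤ (j % 6) (j / 6 ℕ.* 6) ⟩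
      -1ℤ ^ (j % 6) * -1ℤ ^ (j / 6 ℕ.* 6)        ≡⟨ cong (λ e → -1ℤ ^ (j % 6) * -1ℤ ^ e) (ℕₚ.*-comm (j / 6) 6) ⟩
      -1ℤ ^ (j % 6) * -1ℤ ^ (6 ℕ.* (j / 6))      ≡⟨ cong (-1ℤ ^ (j % 6) *_) (sym (ℤₚ.^-*-assoc -1ℤ 6 (j / 6))) ⟩
      -1ℤ ^ (j % 6) * 1ℤ ^ (j / 6)               ≡⟨ cong (-1ℤ ^ (j % 6) *_) (ℤₚ.^-zeroˡ (j / 6)) ⟩
      -1ℤ ^ (j % 6) * 1ℤ                         ≡⟨ ℤₚ.*-identityʳ _ ⟩
      -1ℤ ^ (j % 6)                              ∎
    where open ≡-Reasoning

  -- The factors 1/(1 + q^k) of 1/(−q;q)∞ and 1/(1 − q^k), k ≢ ±1 (mod 6), of the β-partitions.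
  α-coeff β-coeff : ℕ → ℤ
  α-coeff = factorCoeff (λ _ → true) -1ℤ
  β-coeff = factorCoeff not±1mod6 1ℤ

  twisted-pair-positive : ∀ i → PositivePair (twistCoeff α-coeff i) (twistCoeff β-coeff i)
  twisted-pair-positive i rewrite -1^-mod-6 (suc i) with suc i % 6 | m%n<n (suc i) 6
  ... | 0 | _ = minus-plus
  ... | 1 | _ = geometric
  ... | 2 | _ = minus-plus
  ... | 3 | _ = plus-minus
  ... | 4 | _ = minus-plus
  ... | 5 | _ = geometric
  ... | suc (suc (suc (suc (suc (suc _))))) | s≤s (s≤s (s≤s (s≤s (s≤s (s≤s ())))))

  crankProduct : ℕ → Series
  crankProduct K = pairs α-coeff β-coeff K (pairs α-coeff β-coeff K δ)

  ∑crankSign≡crankProduct : ∀ m → ∑ (quads m) crankSign ≡ crankProduct (suc m) m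
  ∑crankSign≡crankProduct m = begin
      ∑ (quads m) crankSign
    ≡⟨ ∑-quads (lengthWeight -1ℤ) (lengthWeight 1ℤ) m ⟩
      conv U (conv V (conv U V)) m
    ≡⟨ conv-agree {K} U≈Pα (conv-agree {K} V≈Pβ (conv-agree {K} U≈Pα V≈Pβ)) (ℕₚ.n≤1+n m) ⟩
      conv Pα (conv Pβ (conv Pα Pβ)) m
    ≡⟨ conv-partitionSeries (λ _ → true) -1ℤ K (conv Pβ (conv Pα Pβ)) m ⟩
      divFactors α-coeff K (conv Pβ (conv Pα Pβ)) m
    ≡⟨ divFactors-cong α-coeff K (conv-partitionSeries not±1mod6 1ℤ K (conv Pα Pβ)) m ⟩
      pairs α-coeff β-coeff K (conv Pα Pβ) m
    ≡⟨ pairs-cong α-coeff β-coeff K (conv-partitionSeries (λ _ → true) -1ℤ K Pβ) m ⟩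
      pairs α-coeff β-coeff K (divFactors α-coeff K Pβ) m
    ≡⟨ pairs-cong α-coeff β-coeff K
                  (divFactors-cong α-coeff K (partitionSeries-divFactors not±1mod6 1ℤ K)) m ⟩
      crankProduct K m
    ∎
    where
    open ≡-Reasoning
    K = suc m
    U = weightedCount partitions (lengthWeight -1ℤ)
    V = weightedCount partitionsNot±1mod6 (lengthWeight 1ℤ)
    Pα = partitionSeries (λ _ → true) -1ℤ K
    Pβ = partitionSeries not±1mod6 1ℤ K
    U≈Pα : U ≗[≤ K ] Pα
    U≈Pα = partitionSeries-stable (λ _ → true) -1ℤ K
    V≈Pβ : V ≗[≤ K ] Pβ
    V≈Pβ = partitionSeries-stable not±1mod6 1ℤ K

  α′ β′ : ℕ → ℤ
  α′ = twistCoeff α-coeff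
  β′ = twistCoeff β-coeff

  twist-crankProduct : ∀ K → twist (crankProduct K) ≗ pairs α′ β′ K (pairs α′ β′ K δ)
  twist-crankProduct K n =
    trans (twist-pairs α-coeff β-coeff K _ n)
          (pairs-cong α′ β′ K (λ m → trans (twist-pairs α-coeff β-coeff K δ m)
                                           (pairs-cong α′ β′ K twist-δ m)) n)

  δ-nonneg : Nonneg δ
  δ-nonneg zero    = +≤+ z≤n
  δ-nonneg (suc n) = +≤+ z≤n

  twisted-crankProduct-positive : ∀ K n → 1ℤ ≤ pairs α′ β′ (suc K) (pairs α′ β′ (suc K) δ) n
  twisted-crankProduct-positive K n = begin
      1ℤ                       ≤⟨ pairs-dominating twisted-pair-positive (suc K) δ-nonneg 0 ⟩
      Z 0                      ≤⟨ pairs-≥-constant-term twisted-pair-positive refl refl K Z-nonneg n ⟩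
      pairs α′ β′ (suc K) Z n  ∎
    where
    open ℤₚ.≤-Reasoning
    Z = pairs α′ β′ (suc K) δ
    Z-nonneg = dominating-nonneg (pairs-dominating twisted-pair-positive (suc K)) δ-nonneg

  signedCount-bias : ∀ m → 1ℤ ≤ -1ℤ ^ m * signedCount m
  signedCount-bias m = begin
      1ℤ                                ≤⟨ twisted-crankProduct-positive m m ⟩
      pairs α′ β′ K (pairs α′ β′ K δ) m ≡⟨ sym (twist-crankProduct K m) ⟩
      -1ℤ ^ m * crankProduct K m        ≡⟨ cong (-1ℤ ^ m *_) (sym (∑crankSign≡crankProduct m)) ⟩
      -1ℤ ^ m * ∑ (quads m) crankSign   ≡⟨ cong (-1ℤ ^ m *_) (sym (signedCount≡∑crankSign m)) ⟩
      -1ℤ ^ m * signedCount m           ∎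
    where
    open ℤₚ.≤-Reasoning
    K = suc m

  <-from-difference : ∀ e o → 1ℤ ≤ + e - + o → o ℕ.< e
  <-from-difference e o 1≤e-o = ℤₚ.drop‿+≤+ (begin
      1ℤ + + o          ≤⟨ ℤₚ.+-monoˡ-≤ (+ o) 1≤e-o ⟩
      (+ e - + o) + + o ≡⟨ cancel (+ e) (+ o) ⟩
      + e               ∎)
    where
    open ℤₚ.≤-Reasoning
    cancel : ∀ x y → (x - y) + y ≡ x
    cancel = solve-∀

  more-even-residues : ∀ n → MbdMod (+ 1) 2 (2 ℕ.* n) ℕ.< MbdMod (+ 0) 2 (2 ℕ.* n)
  more-even-residues n = <-from-difference _ _ (begin
      1ℤ                         ≤⟨ signedCount-bias m ⟩
      -1ℤ ^ m * signedCount m    ≡⟨ cong (_* signedCount m) (-1^-even n) ⟩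
      1ℤ * signedCount m         ≡⟨ ℤₚ.*-identityˡ (signedCount m) ⟩
      signedCount m              ∎)
    where
    open ℤₚ.≤-Reasoning
    m = 2 ℕ.* n

  more-odd-residues : ∀ n → MbdMod (+ 0) 2 (2 ℕ.* n ℕ.+ 1) ℕ.< MbdMod (+ 1) 2 (2 ℕ.* n ℕ.+ 1)
  more-odd-residues n = <-from-difference _ _ (begin
      1ℤ                         ≤⟨ signedCount-bias m ⟩
      -1ℤ ^ m * signedCount m    ≡⟨ cong (_* signedCount m) -1^m≡-1 ⟩
      -1ℤ * signedCount m        ≡⟨ negate (+ MbdMod (+ 0) 2 m) (+ MbdMod (+ 1) 2 m) ⟩
      + MbdMod (+ 1) 2 m - + MbdMod (+ 0) 2 m ∎)
    where
    open ℤₚ.≤-Reasoning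
    m = 2 ℕ.* n ℕ.+ 1
    -1^m≡-1 : -1ℤ ^ m ≡ -1ℤ
    -1^m≡-1 = trans (ℤₚ.^-distribˡ-+-* -1ℤ (2 ℕ.* n) 1) (cong (_* -1ℤ ^ 1) (-1^-even n))
    negate : ∀ x y → -1ℤ * (x - y) ≡ y - x
    negate = solve-∀

open import Defs
open import Data.Nat using (ℕ; _<_; _*_; _+_)
open import Data.Integer using (+_)
open import Data.Product using (_×_; _,_)
open CrankParityBias using (more-even-residues; more-odd-residues)

theorem2p4 : (n : ℕ) →
    (MbdMod (+ 1) 2 (2 * n) < MbdMod (+ 0) 2 (2 * n)) ×
    (MbdMod (+ 0) 2 (2 * n + 1) < MbdMod (+ 1) 2 (2 * n + 1))
theorem2p4 n = more-even-residues n , more-odd-residues n
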